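{- Let $(E,\mathcal F)$ be an upper interval greedoid (antimatroid), and let $\mathcal L$ be the set of all covectors of $(E,\mathcal F)$. Then $(E,\mathcal F,\mathcal L)$ is an oriented interval greedoid.
   Context: An upper interval greedoid (antimatroid) is a finite set $E$ and a nonempty family $\mathcal F$ of subsets satisfying: (IG1) every nonempty $X\in\mathcal F$ has $x\in X$ with $X\setminus\{x\}\in\mathcal F$; (IG2) if $X,Y\in\mathcal F$, $|X|>|Y|$, there is $x\in X\setminus Y$ with $Y\cup\{x\}\in\mathcal F$; (UIP) if $X\subseteq Y$ in $\mathcal F$, $e\in E\setminus Y$ and $X\cup\{e\}\in\mathcal F$, then $Y\cup\{e\}\in\mathcal F$. Such a pair is an interval greedoid, i.e. also satisfies (IG3): if $X\subseteq Y\subseteq Z$ in $\mathcal F$, $e\notin Z$, $X\cup\{e\},Z\cup\{e\}\in\mathcal F$, then $Y\cup\{e\}\in\mathcal F$. For an interval greedoid: $\Gamma(X)=\{x\in E\setminus X:X\cup\{x\}\in\mathcal F\}$; $X\sim Y$ iff $\Gamma(X)=\Gamma(Y)$; classes $[X]$ are flats; $\Phi$ the set of flats ordered by $[X]\le[Y]$ iff there is $Z\subseteq E\setminus Y$ with $Y\cup Z\in\mathcal F$ and $Y\cup Z\sim X$ (a lattice). For a flat $A=[X]$: $\Gamma(A)=\Gamma(X)$, $\xi(A)=\bigcup_{X'\sim X}X'$. $\mu(S)=[X]$ for $X$ inclusion-maximal feasible in $S\subseteq E$; join $A\vee B=\mu(\xi(A)\cap\xi(B))$. A covector is $\alpha:E\to\{0,+,-,1\}$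 such that for some flat $A=\mathrm{supp}(\alpha)$, $\alpha\in\{+,-\}$ on $\Gamma(A)$, $0$ on $\xi(A)$, $1$ elsewhere. Symbols ordered $0<+<1$, $0<-<1$. Product: with $C=\mathrm{supp}\,\alpha\vee\mathrm{supp}\,\beta$, $(\alpha\circ\beta)(e)=\beta(e)$ if $e\in\Gamma(C)\cup\xi(C)$ and $\beta(e)>\alpha(e)$; $\alpha(e)$ if $e\in\Gamma(C)\cup\xi(C)$ otherwise; $1$ otherwise. $-\alpha$ swaps $+,-$; $S(\alpha,\beta)=\{e:\alpha(e)=-\beta(e)\in\{+,-\}\}$. Oriented interval greedoid: $(E,\mathcal F,\mathcal L)$, $\mathcal L$ a set of covectors with (OG1) $\mathrm{supp}:\mathcal L\to\Phi$ surjective; (OG2) $-\mathcal L=\mathcal L$; (OG3) closed under $\circ$; (OG4) if $\alpha,\beta\in\mathcal L$, $x\in S(\alpha,\beta)$, $(\alpha\circ\beta)(x)\ne1$, some $\gamma\in\mathcal L$ has $\gamma(x)=0$ and $\gamma(y)=(\alpha\circ\beta)(y)=(\beta\circ\alpha)(y)$ for all $y\notin S(\alpha,\beta)$ with $(\alpha\circ\beta)(y)\neq1$. -}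

module Defs where

open import Data.Nat using (ℕ; _>_)
open import Data.Bool using (Bool; true)
open import Data.Fin using (Fin)
open import Data.Fin.Subset using (Subset; _∈_; _∉_; _⊆_; _∪_; _-_; ⁅_⁆; ∣_∣; Nonempty)
open import Data.Product using (Σ; ∃; _×_; _,_)
open import Data.Sum using (_⊎_)
open import Relation.Nullary using (¬_)
open import Relation.Binary.PropositionalEquality using (_≡_; _≢_)

module _ {n : ℕ} (F : Subset n → Bool) where

  Feasible : Subset n → Set
  Feasible X = F X ≡ true

  IG1 : Set
  IG1 = ∀ X → Feasible X → Nonempty X → ∃ λ x → x ∈ X × Feasible (X - x)

  IG2 : Set
  IG2 = ∀ X Y → Feasible X → Feasible Y → ∣ X ∣ > ∣ Y ∣ →
        ∃ λ x → x ∈ X × x ∉ Y × Feasible (Y ∪ ⁅ x ⁆)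

  UIP : Set
  UIP = ∀ X Y e → Feasible X → Feasible Y → X ⊆ Y → e ∉ Y →
        Feasible (X ∪ ⁅ e ⁆) → Feasible (Y ∪ ⁅ e ⁆)

  IG3 : Set
  IG3 = ∀ X Y Z e → Feasible X → Feasible Y → Feasible Z → X ⊆ Y → Y ⊆ Z →
        e ∉ Z → Feasible (X ∪ ⁅ e ⁆) → Feasible (Z ∪ ⁅ e ⁆) → Feasible (Y ∪ ⁅ e ⁆)

  NonemptyFamily : Set
  NonemptyFamily = ∃ λ X → Feasible X

  record IsIntervalGreedoid : Set where
    field
      nonempty : NonemptyFamily
      ig1      : IG1
      ig2      : IG2
      ig3      : IG3

  record IsAntimatroid : Set where
    field
      nonempty : NonemptyFamily
      ig1      : IG1
      ig2      : IG2
      uip      : UIP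

  Γ : Subset n → Fin n → Set
  Γ X x = x ∉ X × Feasible (X ∪ ⁅ x ⁆)

  _∼_ : Subset n → Subset n → Set
  X ∼ Y = ∀ x → (Γ X x → Γ Y x) × (Γ Y x → Γ X x)

  ξ : Subset n → Fin n → Set
  ξ X e = ∃ λ X' → Feasible X' × X' ∼ X × e ∈ X'

  -- X is an inclusion-maximal feasible set contained in S (S a predicate on E);
  -- μ(S) = [X] for any such X.
  MaxFeasibleIn : Subset n → (Fin n → Set) → Set
  MaxFeasibleIn X S = Feasible X × (∀ e → e ∈ X → S e) ×
    (∀ Y → Feasible Y → X ⊆ Y → (∀ e → e ∈ Y → S e) → Y ≡ X)

data Sym : Set where
  𝟘 ⊕ ⊖ 𝟙 : Sym

data _<ˢ_ : Sym → Sym → Set where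
  0<+ : 𝟘 <ˢ ⊕
  0<- : 𝟘 <ˢ ⊖
  0<1 : 𝟘 <ˢ 𝟙
  +<1 : ⊕ <ˢ 𝟙
  -<1 : ⊖ <ˢ 𝟙

negˢ : Sym → Sym
negˢ 𝟘 = 𝟘
negˢ ⊕ = ⊖
negˢ ⊖ = ⊕
negˢ 𝟙 = 𝟙

module _ {n : ℕ} where

  Sign : Set
  Sign = Fin n → Sym

  neg : Sign → Sign
  neg α e = negˢ (α e)

  -- zero set of α; for a covector α this is exactly ξ(supp α)
  Zero : Sign → Fin n → Set
  Zero α e = α e ≡ 𝟘

  Sep : Sign → Sign → Fin n → Set
  Sep α β e = (α e ≡ ⊕ × β e ≡ ⊖) ⊎ (α e ≡ ⊖ × β e ≡ ⊕)

module _ {n : ℕ} (F : Subset n → Bool) where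

  -- α is a covector whose support is the flat [X]  (X feasible):
  -- ± on Γ(X), 0 on ξ([X]), 1 elsewhere
  CovectorAt : Subset n → Sign → Set
  CovectorAt X α = Feasible F X × (∀ e →
      (Γ F X e → (α e ≡ ⊕ ⊎ α e ≡ ⊖)) ×
      (ξ F X e → α e ≡ 𝟘) ×
      (¬ Γ F X e → ¬ ξ F X e → α e ≡ 𝟙))

  IsCovector : Sign → Set
  IsCovector α = ∃ λ X → CovectorAt X α

  -- γ = α ∘ β, computed with a representative X of the flat
  -- C = supp α ∨ supp β = μ(ξ(supp α) ∩ ξ(supp β)), i.e. X maximal feasible
  -- inside {e : α e = 0} ∩ {e : β e = 0}.
  ProdAt : Subset n → Sign → Sign → Sign → Set
  ProdAt X α β γ = ∀ e →
      ((Γ F X e ⊎ ξ F X e) → (α e <ˢ β e → γ e ≡ β e) × (¬ (α e <ˢ β e) → γ e ≡ α e)) ×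
      (¬ (Γ F X e ⊎ ξ F X e) → γ e ≡ 𝟙)

  JoinRep : Sign → Sign → Subset n → Set
  JoinRep α β X = MaxFeasibleIn F X (λ e → Zero α e × Zero β e)

  record IsOrientedIntervalGreedoid (L : Sign → Set) : Set where
    field
      intervalGreedoid : IsIntervalGreedoid F
      covectors : ∀ α → L α → IsCovector α
      -- supp : L → Φ is well defined ...
      suppWellDefined : ∀ α X Y → L α → CovectorAt X α → CovectorAt Y α → _∼_ F X Y
      -- (OG1) ... and surjective
      og1 : ∀ X → Feasible F X → ∃ λ α → L α × CovectorAt X α
      og2 : ∀ α → L α → L (neg α)
      og3 : ∀ α β → L α → L β → ∀ X → JoinRep α β X →
            ∃ λ γ → ProdAt X α β γ × L γ
      og4 : ∀ α β → L α → L β → ∀ X → JoinRep α β X →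
            ∀ δ δ' → ProdAt X α β δ → ProdAt X β α δ' →
            ∀ x → Sep α β x → δ x ≢ 𝟙 →
            ∃ λ γ → L γ × γ x ≡ 𝟘 ×
              (∀ y → ¬ Sep α β y → δ y ≢ 𝟙 → (γ y ≡ δ y × γ y ≡ δ' y))

-- In an antimatroid the feasible sets are closed under union, so two feasible
-- sets with the same continuations Γ coincide.  Hence every flat [X] is the
-- single set X, ξ[X] = X, the join of two flats is represented by the maximal
-- feasible X on which both covectors vanish, and a covector is just a feasible
-- X with a choice of signs on Γ(X).  The product α ∘ β is the covector at X
-- carrying the signs of α ∘ β: on Γ(X) neither factor is 1 (upper interval
-- property) and not both are 0 (maximality of X).  For (OG4), a separating x
-- with (α ∘ β)(x) ≠ 1 lies in Γ(X), and the covector at X ∪ {x} carrying the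
-- signs of α ∘ β vanishes at x; off the separation set α ∘ β = β ∘ α.
module Submission where

open import Defs
open import Data.Nat using (ℕ; suc; _<_)
open import Data.Nat.Properties using (<-≤-trans; n<1+n)
open import Data.Nat.Base using (s≤s⁻¹)
open import Data.Bool using (Bool; true)
open import Data.Bool.Properties using () renaming (_≟_ to _≟ᵇ_)
open import Data.Fin using (Fin)
open import Data.Fin.Properties using () renaming (_≟_ to _≟ᶠ_)
open import Data.Fin.Subset
open import Data.Fin.Subset.Properties
open import Data.Product using (∃; _×_; _,_; proj₁; proj₂; swap)
open import Data.Sum using (_⊎_; inj₁; inj₂; [_,_]′)
open import Data.Empty using (⊥-elim)
open import Function using (id)
open import Relation.Nullary using (¬_; Dec; yes; no)
open import Relation.Nullary.Decidable using (¬?; _×-dec_)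
open import Relation.Binary.PropositionalEquality
open ≡-Reasoning

_<ˢ?_ : ∀ a b → Dec (a <ˢ b)
𝟘 <ˢ? 𝟘 = no λ ()
𝟘 <ˢ? ⊕ = yes 0<+
𝟘 <ˢ? ⊖ = yes 0<-
𝟘 <ˢ? 𝟙 = yes 0<1
⊕ <ˢ? 𝟙 = yes +<1
⊖ <ˢ? 𝟙 = yes -<1
⊕ <ˢ? 𝟘 = no λ ()
⊕ <ˢ? ⊕ = no λ ()
⊕ <ˢ? ⊖ = no λ ()
⊖ <ˢ? 𝟘 = no λ ()
⊖ <ˢ? ⊕ = no λ ()
⊖ <ˢ? ⊖ = no λ ()
𝟙 <ˢ? b = no λ ()

_∘ˢ_ : Sym → Sym → Sym
𝟘 ∘ˢ b = b
𝟙 ∘ˢ b = 𝟙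
a ∘ˢ 𝟙 = 𝟙
a ∘ˢ b = a

∘ˢ-<ˢ : ∀ {a b} → a <ˢ b → a ∘ˢ b ≡ b
∘ˢ-<ˢ 0<+ = refl
∘ˢ-<ˢ 0<- = refl
∘ˢ-<ˢ 0<1 = refl
∘ˢ-<ˢ +<1 = refl
∘ˢ-<ˢ -<1 = refl

∘ˢ-≮ˢ : ∀ a b → ¬ (a <ˢ b) → a ∘ˢ b ≡ a
∘ˢ-≮ˢ 𝟘 𝟘 _   = refl
∘ˢ-≮ˢ 𝟘 ⊕ a≮b = ⊥-elim (a≮b 0<+)
∘ˢ-≮ˢ 𝟘 ⊖ a≮b = ⊥-elim (a≮b 0<-)
∘ˢ-≮ˢ 𝟘 𝟙 a≮b = ⊥-elim (a≮b 0<1)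
∘ˢ-≮ˢ ⊕ 𝟙 a≮b = ⊥-elim (a≮b +<1)
∘ˢ-≮ˢ ⊖ 𝟙 a≮b = ⊥-elim (a≮b -<1)
∘ˢ-≮ˢ ⊕ 𝟘 _   = refl
∘ˢ-≮ˢ ⊕ ⊕ _   = refl
∘ˢ-≮ˢ ⊕ ⊖ _   = refl
∘ˢ-≮ˢ ⊖ 𝟘 _   = refl
∘ˢ-≮ˢ ⊖ ⊕ _   = refl
∘ˢ-≮ˢ ⊖ ⊖ _   = refl
∘ˢ-≮ˢ 𝟙 b _   = refl

∘ˢ-unique : ∀ a b c → (a <ˢ b → c ≡ b) × (¬ (a <ˢ b) → c ≡ a) → c ≡ a ∘ˢ b
∘ˢ-unique a b c (if< , if≮) with a <ˢ? b
... | yes a<b = trans (if< a<b) (sym (∘ˢ-<ˢ a<b))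
... | no  a≮b = trans (if≮ a≮b) (sym (∘ˢ-≮ˢ a b a≮b))

∘ˢ-spec : ∀ a b c → c ≡ a ∘ˢ b → (a <ˢ b → c ≡ b) × (¬ (a <ˢ b) → c ≡ a)
∘ˢ-spec a b c refl = ∘ˢ-<ˢ , ∘ˢ-≮ˢ a b

Opposite : Sym → Sym → Set
Opposite a b = (a ≡ ⊕ × b ≡ ⊖) ⊎ (a ≡ ⊖ × b ≡ ⊕)

∘ˢ-comm : ∀ a b → ¬ Opposite a b → a ∘ˢ b ≡ b ∘ˢ a
∘ˢ-comm ⊕ ⊖ ¬opp = ⊥-elim (¬opp (inj₁ (refl , refl)))
∘ˢ-comm ⊖ ⊕ ¬opp = ⊥-elim (¬opp (inj₂ (refl , refl)))
∘ˢ-comm 𝟘 𝟘 _ = refl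
∘ˢ-comm 𝟘 ⊕ _ = refl
∘ˢ-comm 𝟘 ⊖ _ = refl
∘ˢ-comm 𝟘 𝟙 _ = refl
∘ˢ-comm ⊕ 𝟘 _ = refl
∘ˢ-comm ⊕ ⊕ _ = refl
∘ˢ-comm ⊕ 𝟙 _ = refl
∘ˢ-comm ⊖ 𝟘 _ = refl
∘ˢ-comm ⊖ ⊖ _ = refl
∘ˢ-comm ⊖ 𝟙 _ = refl
∘ˢ-comm 𝟙 𝟘 _ = refl
∘ˢ-comm 𝟙 ⊕ _ = refl
∘ˢ-comm 𝟙 ⊖ _ = refl
∘ˢ-comm 𝟙 𝟙 _ = refl

𝟘≢𝟙 : 𝟘 ≢ 𝟙
𝟘≢𝟙 ()

IsSign : Sym → Set
IsSign s = s ≡ ⊕ ⊎ s ≡ ⊖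

sign≢𝟘 : ∀ {s} → IsSign s → s ≢ 𝟘
sign≢𝟘 (inj₁ refl) ()
sign≢𝟘 (inj₂ refl) ()

sign≢𝟙 : ∀ {s} → IsSign s → s ≢ 𝟙
sign≢𝟙 (inj₁ refl) ()
sign≢𝟙 (inj₂ refl) ()

negˢ-sign : ∀ {s} → IsSign s → IsSign (negˢ s)
negˢ-sign (inj₁ refl) = inj₂ refl
negˢ-sign (inj₂ refl) = inj₁ refl

opposite-sign : ∀ {a b} → Opposite a b → IsSign a
opposite-sign (inj₁ (a≡⊕ , _)) = inj₁ a≡⊕
opposite-sign (inj₂ (a≡⊖ , _)) = inj₂ a≡⊖

∘ˢ-sign : ∀ a b → a ≢ 𝟙 → b ≢ 𝟙 → ¬ (a ≡ 𝟘 × b ≡ 𝟘) → IsSign (a ∘ˢ b)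
∘ˢ-sign 𝟘 𝟘 _ _ ¬00 = ⊥-elim (¬00 (refl , refl))
∘ˢ-sign 𝟙 b a≢𝟙 _ _ = ⊥-elim (a≢𝟙 refl)
∘ˢ-sign a 𝟙 _ b≢𝟙 _ = ⊥-elim (b≢𝟙 refl)
∘ˢ-sign 𝟘 ⊕ _ _ _ = inj₁ refl
∘ˢ-sign 𝟘 ⊖ _ _ _ = inj₂ refl
∘ˢ-sign ⊕ 𝟘 _ _ _ = inj₁ refl
∘ˢ-sign ⊕ ⊕ _ _ _ = inj₁ refl
∘ˢ-sign ⊕ ⊖ _ _ _ = inj₁ refl
∘ˢ-sign ⊖ 𝟘 _ _ _ = inj₂ refl
∘ˢ-sign ⊖ ⊕ _ _ _ = inj₂ refl
∘ˢ-sign ⊖ ⊖ _ _ _ = inj₂ refl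

-- Junk value ⊕ at 𝟘 and 𝟙.
toSign : Sym → Sym
toSign ⊖ = ⊖
toSign _ = ⊕

toSign-sign : ∀ s → IsSign (toSign s)
toSign-sign 𝟘 = inj₁ refl
toSign-sign ⊕ = inj₁ refl
toSign-sign ⊖ = inj₂ refl
toSign-sign 𝟙 = inj₁ refl

toSign-id : ∀ {s} → IsSign s → toSign s ≡ s
toSign-id (inj₁ refl) = refl
toSign-id (inj₂ refl) = refl

module _ {n : ℕ} where

  ∪-absorbˡ : {p q : Subset n} → q ⊆ p → p ∪ q ≡ p
  ∪-absorbˡ {p} {q} q⊆p = ⊆-antisym p∪q⊆p (p⊆p∪q q)
    where
    p∪q⊆p : p ∪ q ⊆ p
    p∪q⊆p x∈ = [ id , q⊆p ]′ (x∈p∪q⁻ p q x∈)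

  p∪⁅x⁆≡p : {p : Subset n} {x : Fin n} → x ∈ p → p ∪ ⁅ x ⁆ ≡ p
  p∪⁅x⁆≡p {x = x} x∈p = ∪-absorbˡ λ y∈⁅x⁆ → subst (_∈ _) (sym (x∈⁅y⁆⇒x≡y x y∈⁅x⁆)) x∈p

  p-x∪⁅x⁆≡p : {p : Subset n} {x : Fin n} → x ∈ p → (p - x) ∪ ⁅ x ⁆ ≡ p
  p-x∪⁅x⁆≡p {p} {x} x∈p = ⊆-antisym ⊆p p⊆
    where
    ⊆p : (p - x) ∪ ⁅ x ⁆ ⊆ p
    ⊆p y∈ with x∈p∪q⁻ (p - x) ⁅ x ⁆ y∈
    ... | inj₁ y∈p-x = p─q⊆p p ⁅ x ⁆ y∈p-x
    ... | inj₂ y∈⁅x⁆ rewrite x∈⁅y⁆⇒x≡y x y∈⁅x⁆ = x∈p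
    p⊆ : p ⊆ (p - x) ∪ ⁅ x ⁆
    p⊆ {y} y∈p with y ≟ᶠ x
    ... | yes refl = q⊆p∪q (p - x) ⁅ x ⁆ (x∈⁅x⁆ x)
    ... | no  y≢x  = p⊆p∪q ⁅ x ⁆ (x∈p∧x≢y⇒x∈p-y y∈p y≢x)

  p-x∪q∪⁅x⁆≡p∪q : {p : Subset n} (q : Subset n) {x : Fin n} → x ∈ p →
                  ((p - x) ∪ q) ∪ ⁅ x ⁆ ≡ p ∪ q
  p-x∪q∪⁅x⁆≡p∪q {p} q {x} x∈p = begin
    ((p - x) ∪ q) ∪ ⁅ x ⁆  ≡⟨ ∪-assoc (p - x) q ⁅ x ⁆ ⟩
    (p - x) ∪ (q ∪ ⁅ x ⁆)  ≡⟨ cong ((p - x) ∪_) (∪-comm q ⁅ x ⁆) ⟩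
    (p - x) ∪ (⁅ x ⁆ ∪ q)  ≡⟨ ∪-assoc (p - x) ⁅ x ⁆ q ⟨
    ((p - x) ∪ ⁅ x ⁆) ∪ q  ≡⟨ cong (_∪ q) (p-x∪⁅x⁆≡p x∈p) ⟩
    p ∪ q                  ∎

module Antimatroid {n : ℕ} {F : Subset n → Bool} (AM : IsAntimatroid F) where
  open IsAntimatroid AM

  ig3 : IG3 F
  ig3 X Y Z e fX fY _ X⊆Y Y⊆Z e∉Z fXe _ = uip X Y e fX fY X⊆Y (λ e∈Y → e∉Z (Y⊆Z e∈Y)) fXe

  isIntervalGreedoid : IsIntervalGreedoid F
  isIntervalGreedoid = record { nonempty = nonempty ; ig1 = ig1 ; ig2 = ig2 ; ig3 = ig3 }

  -- Strip an element x off X by (IG1), and put it back into (X - x) ∪ Y by (UIP).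
  ∪-feasible-bounded : ∀ k X Y → ∣ X ∣ < k → Feasible F X → Feasible F Y → Feasible F (X ∪ Y)
  ∪-feasible-bounded (suc k) X Y ∣X∣<k fX fY with nonempty? X
  ... | no X≡∅ = subst (Feasible F) (sym X∪Y≡Y) fY
    where
    X∪Y≡Y : X ∪ Y ≡ Y
    X∪Y≡Y = trans (∪-comm X Y) (∪-absorbˡ λ {e} e∈X → ⊥-elim (X≡∅ (e , e∈X)))
  ... | yes X≢∅ with ig1 X fX X≢∅
  ... | x , x∈X , fX-x
    with ∪-feasible-bounded k (X - x) Y (<-≤-trans (x∈p⇒∣p-x∣<∣p∣ x∈X) (s≤s⁻¹ ∣X∣<k)) fX-x fY
  ... | fU with x ∈? ((X - x) ∪ Y)
  ...   | yes x∈U = subst (Feasible F) (trans (sym (p∪⁅x⁆≡p x∈U)) (p-x∪q∪⁅x⁆≡p∪q Y x∈X)) fU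
  ...   | no  x∉U = subst (Feasible F) (p-x∪q∪⁅x⁆≡p∪q Y x∈X)
            (uip (X - x) ((X - x) ∪ Y) x fX-x fU (p⊆p∪q Y) x∉U
                 (subst (Feasible F) (sym (p-x∪⁅x⁆≡p x∈X)) fX))

  ∪-feasible : ∀ {X Y} → Feasible F X → Feasible F Y → Feasible F (X ∪ Y)
  ∪-feasible {X} {Y} = ∪-feasible-bounded (suc ∣ X ∣) X Y (n<1+n _)

  -- If e ∈ X ∖ Y then ∣ X ∪ Y ∣ > ∣ Y ∣, and (IG2) extends Y inside X ∪ Y by
  -- an element of Γ(Y) = Γ(X), which can lie neither in X nor in Y.
  ∼⇒⊆ : ∀ {X Y} → Feasible F X → Feasible F Y → _∼_ F X Y → X ⊆ Y
  ∼⇒⊆ {X} {Y} fX fY X∼Y {e} e∈X with e ∈? Y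
  ... | yes e∈Y = e∈Y
  ... | no  e∉Y
    with ig2 (X ∪ Y) Y (∪-feasible fX fY) fY
             (p⊂q⇒∣p∣<∣q∣ (q⊆p∪q X Y , e , p⊆p∪q Y e∈X , e∉Y))
  ... | x , x∈X∪Y , x∉Y , fYx with proj₂ (X∼Y x) (x∉Y , fYx)
  ... | x∉X , _ = ⊥-elim ([ x∉X , x∉Y ]′ (x∈p∪q⁻ X Y x∈X∪Y))

  ∼⇒≡ : ∀ {X Y} → Feasible F X → Feasible F Y → _∼_ F X Y → X ≡ Y
  ∼⇒≡ fX fY X∼Y = ⊆-antisym (∼⇒⊆ fX fY X∼Y) (∼⇒⊆ fY fX (λ x → swap (X∼Y x)))

  ξ⇒∈ : ∀ {X e} → Feasible F X → ξ F X e → e ∈ X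
  ξ⇒∈ {e = e} fX (X' , fX' , X'∼X , e∈X') = subst (e ∈_) (∼⇒≡ fX' fX X'∼X) e∈X'

  ∈⇒ξ : ∀ {X e} → Feasible F X → e ∈ X → ξ F X e
  ∈⇒ξ {X} fX e∈X = X , fX , (λ _ → id , id) , e∈X

  Γ? : ∀ X e → Dec (Γ F X e)
  Γ? X e = ¬? (e ∈? X) ×-dec (F (X ∪ ⁅ e ⁆) ≟ᵇ true)

  Γ-extend : ∀ {X x y} → Feasible F X → Γ F X x → Γ F X y → y ≢ x → Γ F (X ∪ ⁅ x ⁆) y
  Γ-extend {X} {x} {y} fX (_ , fXx) (y∉X , fXy) y≢x =
    y∉X∪x , uip X (X ∪ ⁅ x ⁆) y fX fXx (p⊆p∪q ⁅ x ⁆) y∉X∪x fXy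
    where
    y∉X∪x : y ∉ X ∪ ⁅ x ⁆
    y∉X∪x y∈ = [ y∉X , x≢y⇒x∉⁅y⁆ y≢x ]′ (x∈p∪q⁻ X ⁅ x ⁆ y∈)

  covectorOf : Subset n → Sign → Sign
  covectorOf X s e with e ∈? X | Γ? X e
  ... | yes _ | _     = 𝟘
  ... | no  _ | yes _ = toSign (s e)
  ... | no  _ | no  _ = 𝟙

  covectorOf-∈ : ∀ {X s e} → e ∈ X → covectorOf X s e ≡ 𝟘
  covectorOf-∈ {X} {s} {e} e∈X with e ∈? X
  ... | yes _   = refl
  ... | no  e∉X = ⊥-elim (e∉X e∈X)

  covectorOf-Γ : ∀ {X s e} → Γ F X e → covectorOf X s e ≡ toSign (s e)
  covectorOf-Γ {X} {s} {e} e∈Γ with e ∈? X | Γ? X e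
  ... | yes e∈X | _     = ⊥-elim (proj₁ e∈Γ e∈X)
  ... | no  _   | yes _ = refl
  ... | no  _   | no  e∉Γ = ⊥-elim (e∉Γ e∈Γ)

  covectorOf-∉ : ∀ {X s e} → e ∉ X → ¬ Γ F X e → covectorOf X s e ≡ 𝟙
  covectorOf-∉ {X} {s} {e} e∉X e∉Γ with e ∈? X | Γ? X e
  ... | yes e∈X | _       = ⊥-elim (e∉X e∈X)
  ... | no  _   | yes e∈Γ = ⊥-elim (e∉Γ e∈Γ)
  ... | no  _   | no  _   = refl

  covectorOf-covectorAt : ∀ {X} → Feasible F X → (s : Sign) → CovectorAt F X (covectorOf X s)
  covectorOf-covectorAt {X} fX s = fX , λ e →
    (λ e∈Γ → subst IsSign (sym (covectorOf-Γ e∈Γ)) (toSign-sign (s e))) ,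
    (λ e∈ξ → covectorOf-∈ (ξ⇒∈ fX e∈ξ)) ,
    (λ e∉Γ e∉ξ → covectorOf-∉ (λ e∈X → e∉ξ (∈⇒ξ fX e∈X)) e∉Γ)

  covector-∈⇒𝟘 : ∀ {A α e} → CovectorAt F A α → e ∈ A → α e ≡ 𝟘
  covector-∈⇒𝟘 {e = e} (fA , at) e∈A = proj₁ (proj₂ (at e)) (∈⇒ξ fA e∈A)

  covector-𝟘⇒∈ : ∀ {A α e} → CovectorAt F A α → α e ≡ 𝟘 → e ∈ A
  covector-𝟘⇒∈ {A} {α} {e} (fA , at) αe≡𝟘 with e ∈? A | Γ? A e
  ... | yes e∈A | _       = e∈A
  ... | no  _   | yes e∈Γ = ⊥-elim (sign≢𝟘 (proj₁ (at e) e∈Γ) αe≡𝟘)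
  ... | no  e∉A | no  e∉Γ =
    ⊥-elim (𝟘≢𝟙 (trans (sym αe≡𝟘) (proj₂ (proj₂ (at e)) e∉Γ (λ e∈ξ → e∉A (ξ⇒∈ fA e∈ξ)))))

  -- By (UIP), Γ(X) ⊆ A ∪ Γ(A) whenever X ⊆ A.
  covector-≢𝟙 : ∀ {A α X e} → CovectorAt F A α → Feasible F X → X ⊆ A → Γ F X e → α e ≢ 𝟙
  covector-≢𝟙 {A} {α} {X} {e} cA fX X⊆A (_ , fXe) with e ∈? A
  ... | yes e∈A = λ αe≡𝟙 → 𝟘≢𝟙 (trans (sym (covector-∈⇒𝟘 cA e∈A)) αe≡𝟙)
  ... | no  e∉A = sign≢𝟙 (proj₁ (proj₂ cA e) (e∉A , uip X A e fX (proj₁ cA) X⊆A e∉A fXe))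

  covector-Γ⊆ : ∀ {X Y α} → CovectorAt F X α → CovectorAt F Y α → ∀ e → Γ F X e → Γ F Y e
  covector-Γ⊆ {X} {Y} (_ , atX) (_ , atY) e e∈ΓX with Γ? Y e
  ... | yes e∈ΓY = e∈ΓY
  ... | no  e∉ΓY = ⊥-elim (sign≢𝟙 αe-sign (proj₂ (proj₂ (atY e)) e∉ΓY
                     λ e∈ξ → sign≢𝟘 αe-sign (proj₁ (proj₂ (atY e)) e∈ξ)))
    where
    αe-sign = proj₁ (atX e) e∈ΓX

  covector-neg : ∀ {A α} → CovectorAt F A α → CovectorAt F A (neg α)
  covector-neg (fA , at) = fA , λ e →
    (λ e∈Γ → negˢ-sign (proj₁ (at e) e∈Γ)) ,
    (λ e∈ξ → cong negˢ (proj₁ (proj₂ (at e)) e∈ξ)) ,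
    (λ e∉Γ e∉ξ → cong negˢ (proj₂ (proj₂ (at e)) e∉Γ e∉ξ))

  joinRep-swap : ∀ {α β X} → JoinRep F α β X → JoinRep F β α X
  joinRep-swap (fX , zeroOnX , maximal) =
    fX , (λ e e∈X → swap (zeroOnX e e∈X)) ,
    (λ Z fZ X⊆Z zeroOnZ → maximal Z fZ X⊆Z λ e e∈Z → swap (zeroOnZ e e∈Z))

  joinRep-⊆ : ∀ {α β X A} → JoinRep F α β X → CovectorAt F A α → X ⊆ A
  joinRep-⊆ (_ , zeroOnX , _) cA {e} e∈X = covector-𝟘⇒∈ cA (proj₁ (zeroOnX e e∈X))

  joinRep-Γ-≢𝟘 : ∀ {α β X e} → JoinRep F α β X → Γ F X e → ¬ (α e ≡ 𝟘 × β e ≡ 𝟘)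
  joinRep-Γ-≢𝟘 {α} {β} {X} {e} (_ , zeroOnX , maximal) (e∉X , fXe) zeroAtE =
    e∉X (subst (e ∈_) X∪e≡X (q⊆p∪q X ⁅ e ⁆ (x∈⁅x⁆ e)))
    where
    zeroOnX∪e : ∀ y → y ∈ X ∪ ⁅ e ⁆ → α y ≡ 𝟘 × β y ≡ 𝟘
    zeroOnX∪e y y∈ with x∈p∪q⁻ X ⁅ e ⁆ y∈
    ... | inj₁ y∈X = zeroOnX y y∈X
    ... | inj₂ y∈⁅e⁆ rewrite x∈⁅y⁆⇒x≡y e y∈⁅e⁆ = zeroAtE
    X∪e≡X : X ∪ ⁅ e ⁆ ≡ X
    X∪e≡X = maximal (X ∪ ⁅ e ⁆) fXe (p⊆p∪q ⁅ e ⁆) zeroOnX∪e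

  joinRep-Γ-∘ˢ-sign : ∀ {α β X A B e} → JoinRep F α β X → CovectorAt F A α → CovectorAt F B β →
                      Γ F X e → IsSign (α e ∘ˢ β e)
  joinRep-Γ-∘ˢ-sign {α} {β} {e = e} jr cA cB e∈Γ =
    ∘ˢ-sign (α e) (β e) (covector-≢𝟙 cA fX (joinRep-⊆ jr cA) e∈Γ)
                        (covector-≢𝟙 cB fX (joinRep-⊆ (joinRep-swap jr) cB) e∈Γ)
                        (joinRep-Γ-≢𝟘 jr e∈Γ)
    where
    fX = proj₁ jr

  product-∘ˢ : ∀ {X α β δ e} → Feasible F X → ProdAt F X α β δ →
               Γ F X e ⊎ e ∈ X → δ e ≡ α e ∘ˢ β e
  product-∘ˢ {α = α} {β} {δ} {e} fX prod e∈ =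
    ∘ˢ-unique (α e) (β e) (δ e) (proj₁ (prod e) ([ inj₁ , (λ e∈X → inj₂ (∈⇒ξ fX e∈X)) ]′ e∈))

  product-≢𝟙 : ∀ {X α β δ e} → Feasible F X → ProdAt F X α β δ → δ e ≢ 𝟙 → Γ F X e ⊎ e ∈ X
  product-≢𝟙 {X} {e = e} fX prod δe≢𝟙 with Γ? X e | e ∈? X
  ... | yes e∈Γ | _       = inj₁ e∈Γ
  ... | no  _   | yes e∈X = inj₂ e∈X
  ... | no  e∉Γ | no  e∉X = ⊥-elim (δe≢𝟙 (proj₂ (prod e) [ e∉Γ , (λ e∈ξ → e∉X (ξ⇒∈ fX e∈ξ)) ]′))

  product-∈⇒𝟘 : ∀ {X α β δ e} → JoinRep F α β X → ProdAt F X α β δ → e ∈ X → δ e ≡ 𝟘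
  product-∈⇒𝟘 {α = α} {β} {δ} {e} (fX , zeroOnX , _) prod e∈X = begin
    δ e          ≡⟨ product-∘ˢ fX prod (inj₂ e∈X) ⟩
    α e ∘ˢ β e   ≡⟨ cong₂ _∘ˢ_ (proj₁ (zeroOnX e e∈X)) (proj₂ (zeroOnX e e∈X)) ⟩
    𝟘            ∎

  product-covector : ∀ α β → IsCovector F α → IsCovector F β → ∀ X → JoinRep F α β X →
                     ∃ λ γ → ProdAt F X α β γ × IsCovector F γ
  product-covector α β (_ , cA) (_ , cB) X jr@(fX , zeroOnX , _) =
    γ , γ-product , X , covectorOf-covectorAt fX α∘β
    where
    α∘β : Sign
    α∘β e = α e ∘ˢ β e
    γ = covectorOf X α∘β
    γ≡α∘β : ∀ e → Γ F X e ⊎ e ∈ X → γ e ≡ α∘β e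
    γ≡α∘β e (inj₁ e∈Γ) = trans (covectorOf-Γ e∈Γ) (toSign-id (joinRep-Γ-∘ˢ-sign jr cA cB e∈Γ))
    γ≡α∘β e (inj₂ e∈X) = trans (covectorOf-∈ e∈X)
      (sym (cong₂ _∘ˢ_ (proj₁ (zeroOnX e e∈X)) (proj₂ (zeroOnX e e∈X))))
    γ-product : ProdAt F X α β γ
    γ-product e =
      (λ e∈ → ∘ˢ-spec (α e) (β e) (γ e) (γ≡α∘β e ([ inj₁ , (λ e∈ξ → inj₂ (ξ⇒∈ fX e∈ξ)) ]′ e∈))) ,
      (λ e∉ → covectorOf-∉ (λ e∈X → e∉ (inj₂ (∈⇒ξ fX e∈X))) (λ e∈Γ → e∉ (inj₁ e∈Γ)))

  elimination : ∀ α β → IsCovector F α → IsCovector F β → ∀ X → JoinRep F α β X →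
                ∀ δ δ' → ProdAt F X α β δ → ProdAt F X β α δ' →
                ∀ x → Sep α β x → δ x ≢ 𝟙 →
                ∃ λ γ → IsCovector F γ × γ x ≡ 𝟘 ×
                  (∀ y → ¬ Sep α β y → δ y ≢ 𝟙 → (γ y ≡ δ y × γ y ≡ δ' y))
  elimination α β (_ , cA) (_ , cB) X jr@(fX , zeroOnX , _) δ δ' prod prod' x x-sep δx≢𝟙 =
    γ , (X ∪ ⁅ x ⁆ , covectorOf-covectorAt (proj₂ x∈Γ) δ) ,
    covectorOf-∈ (q⊆p∪q X ⁅ x ⁆ (x∈⁅x⁆ x)) , γ≡δ,δ'
    where
    γ = covectorOf (X ∪ ⁅ x ⁆) δ
    x∈Γ : Γ F X x
    x∈Γ with product-≢𝟙 fX prod δx≢𝟙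
    ... | inj₁ x∈Γ = x∈Γ
    ... | inj₂ x∈X = ⊥-elim (sign≢𝟘 (opposite-sign x-sep) (proj₁ (zeroOnX x x∈X)))
    γ≡δ,δ' : ∀ y → ¬ Sep α β y → δ y ≢ 𝟙 → (γ y ≡ δ y × γ y ≡ δ' y)
    γ≡δ,δ' y y-nsep δy≢𝟙 with product-≢𝟙 fX prod δy≢𝟙
    ... | inj₂ y∈X =
      trans γy≡𝟘 (sym (product-∈⇒𝟘 jr prod y∈X)) ,
      trans γy≡𝟘 (sym (product-∈⇒𝟘 (joinRep-swap jr) prod' y∈X))
      where
      γy≡𝟘 = covectorOf-∈ (p⊆p∪q ⁅ x ⁆ y∈X)
    ... | inj₁ y∈Γ = γy≡δy , trans γy≡δy δy≡δ'y
      where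
      δy≡α∘β = product-∘ˢ fX prod (inj₁ y∈Γ)
      γy≡δy : γ y ≡ δ y
      γy≡δy = begin
        γ y                    ≡⟨ covectorOf-Γ (Γ-extend fX x∈Γ y∈Γ λ { refl → y-nsep x-sep }) ⟩
        toSign (δ y)           ≡⟨ toSign-id (subst IsSign (sym δy≡α∘β) (joinRep-Γ-∘ˢ-sign jr cA cB y∈Γ)) ⟩
        δ y                    ∎
      δy≡δ'y : δ y ≡ δ' y
      δy≡δ'y = begin
        δ y                    ≡⟨ δy≡α∘β ⟩
        α y ∘ˢ β y             ≡⟨ ∘ˢ-comm (α y) (β y) y-nsep ⟩
        β y ∘ˢ α y             ≡⟨ product-∘ˢ fX prod' (inj₁ y∈Γ) ⟨
        δ' y                   ∎

  isOrientedIntervalGreedoid : IsOrientedIntervalGreedoid F (IsCovector F)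
  isOrientedIntervalGreedoid = record
    { intervalGreedoid = isIntervalGreedoid
    ; covectors        = λ _ isCov → isCov
    ; suppWellDefined  = λ _ _ _ _ cX cY e → covector-Γ⊆ cX cY e , covector-Γ⊆ cY cX e
    ; og1              = λ X fX → covectorOf X (λ _ → ⊕) , (X , at X fX) , at X fX
    ; og2              = λ { _ (A , cA) → A , covector-neg cA }
    ; og3              = product-covector
    ; og4              = elimination
    }
    where
    at : ∀ X → Feasible F X → CovectorAt F X (covectorOf X (λ _ → ⊕))
    at X fX = covectorOf-covectorAt fX (λ _ → ⊕)

mainTheorem6 : (n : ℕ) (F : Subset n → Bool) → IsAntimatroid F →
    IsOrientedIntervalGreedoid F (IsCovector F)
mainTheorem6 n F AM = Antimatroid.isOrientedIntervalGreedoid AM
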